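{- The quasivariety $\mathsf{NBCA}$ is structurally complete.
   Context: Let $\mathbf{WK}^e$ be the three-element algebra on $\{0,\tfrac12,1\}$ with $\neg 1=0,\neg\tfrac12=\tfrac12,\neg0=1$; $\vee,\wedge$ equal to $\tfrac12$ when one argument is $\tfrac12$ and Boolean otherwise; $J_0:0\mapsto1,\tfrac12\mapsto0,1\mapsto0$; $J_1:\tfrac12\mapsto1$, $0,1\mapsto 0$; $J_2:1\mapsto1$, $0,\tfrac12\mapsto0$. $\mathsf{BCA}=ISP(\mathbf{WK}^e)$ is the quasivariety of Bochvar algebras; $\mathsf{NBCA}$ is its subquasivariety axiomatized by adding $J_1x\approx1\Rightarrow y\approx1$. A quasivariety $\mathsf{K}$ is structurally complete if for every quasivariety $\mathsf{K}'\subsetneq\mathsf{K}$ one has $\mathbb{V}(\mathsf{K}')\subsetneq\mathbb{V}(\mathsf{K})$, where $\mathbb{V}(\cdot)=HSP(\cdot)$ denotes the generated variety. -}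

module Defs where

open import Level using (0ℓ; Lift; suc)
open import Data.Nat using (ℕ)
open import Data.Product using (Σ; _×_; _,_)
open import Data.List using (List)
open import Data.List.Relation.Unary.All using (All)
open import Relation.Binary using (Rel; IsEquivalence)
open import Relation.Binary.PropositionalEquality using (_≡_; isEquivalence; cong; cong₂)
open import Relation.Nullary using (¬_)

record Algebra : Set₁ where
  field
    Carrier : Set
    _≈_     : Rel Carrier 0ℓ
    isEquiv : IsEquivalence _≈_
    ⊥ₐ ⊤ₐ   : Carrier
    ¬ₐ_     : Carrier → Carrier
    J₀ J₁ J₂ : Carrier → Carrier
    _∨ₐ_ _∧ₐ_ : Carrier → Carrier → Carrier
    ¬-cong  : ∀ {x y} → x ≈ y → (¬ₐ x) ≈ (¬ₐ y)
    J₀-cong : ∀ {x y} → x ≈ y → J₀ x ≈ J₀ y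
    J₁-cong : ∀ {x y} → x ≈ y → J₁ x ≈ J₁ y
    J₂-cong : ∀ {x y} → x ≈ y → J₂ x ≈ J₂ y
    ∨-cong  : ∀ {x y u v} → x ≈ y → u ≈ v → (x ∨ₐ u) ≈ (y ∨ₐ v)
    ∧-cong  : ∀ {x y u v} → x ≈ y → u ≈ v → (x ∧ₐ u) ≈ (y ∧ₐ v)

open Algebra public

record Hom (A B : Algebra) : Set where
  field
    fun   : Carrier A → Carrier B
    resp  : ∀ {x y} → _≈_ A x y → _≈_ B (fun x) (fun y)
    pres-⊥ : _≈_ B (fun (⊥ₐ A)) (⊥ₐ B)
    pres-⊤ : _≈_ B (fun (⊤ₐ A)) (⊤ₐ B)
    pres-¬ : ∀ x → _≈_ B (fun (¬ₐ_ A x)) (¬ₐ_ B (fun x))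
    pres-J₀ : ∀ x → _≈_ B (fun (J₀ A x)) (J₀ B (fun x))
    pres-J₁ : ∀ x → _≈_ B (fun (J₁ A x)) (J₁ B (fun x))
    pres-J₂ : ∀ x → _≈_ B (fun (J₂ A x)) (J₂ B (fun x))
    pres-∨ : ∀ x y → _≈_ B (fun (_∨ₐ_ A x y)) (_∨ₐ_ B (fun x) (fun y))
    pres-∧ : ∀ x y → _≈_ B (fun (_∧ₐ_ A x y)) (_∧ₐ_ B (fun x) (fun y))

open Hom public

Injective : ∀ {A B} → Hom A B → Set
Injective {A} {B} h = ∀ {x y} → _≈_ B (fun h x) (fun h y) → _≈_ A x y

Surjective : ∀ {A B} → Hom A B → Set
Surjective {A} {B} h = ∀ b → Σ (Carrier A) λ a → _≈_ B (fun h a) b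

Embedding : Algebra → Algebra → Set
Embedding A B = Σ (Hom A B) Injective

Iso : Algebra → Algebra → Set
Iso A B = Σ (Hom A B) λ h → Injective h × Surjective h

Π : (I : Set) → (I → Algebra) → Algebra
Π I B = record
  { Carrier = (i : I) → Carrier (B i)
  ; _≈_ = λ f g → ∀ i → _≈_ (B i) (f i) (g i)
  ; isEquiv = record
      { refl = λ i → IsEquivalence.refl (isEquiv (B i))
      ; sym = λ p i → IsEquivalence.sym (isEquiv (B i)) (p i)
      ; trans = λ p q i → IsEquivalence.trans (isEquiv (B i)) (p i) (q i) }
  ; ⊥ₐ = λ i → ⊥ₐ (B i)
  ; ⊤ₐ = λ i → ⊤ₐ (B i)
  ; ¬ₐ_ = λ f i → ¬ₐ_ (B i) (f i)
  ; J₀ = λ f i → J₀ (B i) (f i)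
  ; J₁ = λ f i → J₁ (B i) (f i)
  ; J₂ = λ f i → J₂ (B i) (f i)
  ; _∨ₐ_ = λ f g i → _∨ₐ_ (B i) (f i) (g i)
  ; _∧ₐ_ = λ f g i → _∧ₐ_ (B i) (f i) (g i)
  ; ¬-cong = λ p i → ¬-cong (B i) (p i)
  ; J₀-cong = λ p i → J₀-cong (B i) (p i)
  ; J₁-cong = λ p i → J₁-cong (B i) (p i)
  ; J₂-cong = λ p i → J₂-cong (B i) (p i)
  ; ∨-cong = λ p q i → ∨-cong (B i) (p i) (q i)
  ; ∧-cong = λ p q i → ∧-cong (B i) (p i) (q i)
  }

Class : Set₂
Class = Algebra → Set₁

_⊆_ : Class → Class → Set₁
K ⊆ K′ = ∀ A → K A → K′ A

_⊊_ : Class → Class → Set₁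
K′ ⊊ K = (K′ ⊆ K) × ¬ (K ⊆ K′)

H : Class → Class
H K A = Σ Algebra λ B → K B × Σ (Hom B A) Surjective

S : Class → Class
S K A = Σ Algebra λ B → K B × Embedding A B

P : Class → Class
P K A = Σ Set λ I → Σ (I → Algebra) λ B → ((i : I) → K (B i)) × Iso A (Π I B)

𝕍 : Class → Class
𝕍 K = H (S (P K))

data Term : Set where
  var  : ℕ → Term
  `0 `1 : Term
  `¬ `J₀ `J₁ `J₂ : Term → Term
  _`∨_ _`∧_ : Term → Term → Term

⟦_⟧ : Term → (A : Algebra) → (ℕ → Carrier A) → Carrier A
⟦ var n ⟧ A ρ = ρ n
⟦ `0 ⟧ A ρ = ⊥ₐ A
⟦ `1 ⟧ A ρ = ⊤ₐ A
⟦ `¬ t ⟧ A ρ = ¬ₐ_ A (⟦ t ⟧ A ρ)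
⟦ `J₀ t ⟧ A ρ = J₀ A (⟦ t ⟧ A ρ)
⟦ `J₁ t ⟧ A ρ = J₁ A (⟦ t ⟧ A ρ)
⟦ `J₂ t ⟧ A ρ = J₂ A (⟦ t ⟧ A ρ)
⟦ t `∨ u ⟧ A ρ = _∨ₐ_ A (⟦ t ⟧ A ρ) (⟦ u ⟧ A ρ)
⟦ t `∧ u ⟧ A ρ = _∧ₐ_ A (⟦ t ⟧ A ρ) (⟦ u ⟧ A ρ)

Equation : Set
Equation = Term × Term

HoldsAt : (A : Algebra) → (ℕ → Carrier A) → Equation → Set
HoldsAt A ρ (t , u) = _≈_ A (⟦ t ⟧ A ρ) (⟦ u ⟧ A ρ)

QuasiIdentity : Set
QuasiIdentity = List Equation × Equation

_⊨_ : Algebra → QuasiIdentity → Set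
A ⊨ (prem , concl) = (ρ : ℕ → Carrier A) → All (HoldsAt A ρ) prem → HoldsAt A ρ concl

Mod : (QuasiIdentity → Set) → Class
Mod Σq A = Lift (suc 0ℓ) (∀ q → Σq q → A ⊨ q)

IsQuasivariety : Class → Set₁
IsQuasivariety K = Σ (QuasiIdentity → Set) λ Σq →
  (A : Algebra) → (K A → Mod Σq A) × (Mod Σq A → K A)

StructurallyComplete : Class → Set₂
StructurallyComplete K =
  (K′ : Class) → IsQuasivariety K′ → K′ ⊊ K → 𝕍 K′ ⊊ 𝕍 K

data W : Set where
  w0 wh w1 : W

negW : W → W
negW w0 = w1
negW wh = wh
negW w1 = w0

joinW : W → W → W
joinW wh _ = wh
joinW _ wh = wh
joinW w0 w0 = w0
joinW w0 w1 = w1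
joinW w1 w0 = w1
joinW w1 w1 = w1

meetW : W → W → W
meetW wh _ = wh
meetW _ wh = wh
meetW w0 w0 = w0
meetW w0 w1 = w0
meetW w1 w0 = w0
meetW w1 w1 = w1

J0W J1W J2W : W → W
J0W w0 = w1
J0W wh = w0
J0W w1 = w0
J1W w0 = w0
J1W wh = w1
J1W w1 = w0
J2W w0 = w0
J2W wh = w0
J2W w1 = w1

WKe : Algebra
WKe = record
  { Carrier = W ; _≈_ = _≡_ ; isEquiv = isEquivalence
  ; ⊥ₐ = w0 ; ⊤ₐ = w1 ; ¬ₐ_ = negW ; J₀ = J0W ; J₁ = J1W ; J₂ = J2W
  ; _∨ₐ_ = joinW ; _∧ₐ_ = meetW
  ; ¬-cong = cong negW ; J₀-cong = cong J0W ; J₁-cong = cong J1W ; J₂-cong = cong J2W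
  ; ∨-cong = cong₂ joinW ; ∧-cong = cong₂ meetW }

-- BCA = ISP(WK^e),  NBCA = BCA + (J₁ x ≈ 1 ⇒ y ≈ 1)

IsoToWKe : Class
IsoToWKe A = Lift (suc 0ℓ) (Iso A WKe)

BCA : Class
BCA = S (P IsoToWKe)

nbca-qi : QuasiIdentity
nbca-qi = (List._∷_ (`J₁ (var 0) , `1) List.[]) , (var 1 , `1)
  where import Data.List as List

NBCA : Class
NBCA A = BCA A × Lift (suc 0ℓ) (A ⊨ nbca-qi)

-- Let 𝔽 be the free algebra of ISP(WKᵉ) on countably many generators: terms identified when they agree in
-- WKᵉ under every valuation. It lies in NBCA, and whenever 𝔽 ∈ 𝕍(K′) for K′ ⊆ BCA, 𝔽 embeds into its preimage
-- in SP(K′), so 𝔽 satisfies every quasi-identity of K′. Structural completeness thus reduces to: every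
-- quasi-identity valid in 𝔽 is valid in NBCA.
-- Let A ∈ NBCA be separated by homomorphisms into WKᵉ, and let the premises hold at a valuation of A with
-- coordinates σᵢ. If the conclusion failed at σᵢ while the premise variables were Boolean at some σⱼ, substitute
-- for each generator xₙ a unary term in a fresh variable equal to σᵢ(xₙ) at ½ and to σⱼ(xₙ) at 0 and 1; the
-- premises then hold in 𝔽 but the conclusion fails. So the join D of the premise variables is ½ in every
-- coordinate, J₁ D = 1 in A, and the axiom J₁ x ≈ 1 ⇒ y ≈ 1 forces 0 = 1 in A, which the coordinate σᵢ rules out.

module Submission where

open import Defs
open import Level using (lift; lower)
open import Function using (_∘_)
open import Data.Nat using (ℕ; zero; suc)
open import Data.Product using (Σ; _×_; _,_; proj₁; proj₂)
open import Data.Sum using (_⊎_; inj₁; inj₂)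
open import Data.List using (List; []; _∷_)
open import Data.List.Relation.Unary.All as All using (All; []; _∷_)
open import Data.Unit using (⊤; tt)
open import Data.Empty using (⊥-elim)
open import Relation.Nullary using (¬_; yes; no)
open import Relation.Binary using (IsEquivalence; DecidableEquality)
open import Relation.Binary.PropositionalEquality using (_≡_; _≢_; refl; sym; trans; cong; cong₂)

module ≈ (A : Algebra) = IsEquivalence (isEquiv A)

idHom : (A : Algebra) → Hom A A
idHom A = record
  { fun = λ x → x ; resp = λ p → p ; pres-⊥ = ≈.refl A ; pres-⊤ = ≈.refl A
  ; pres-¬ = λ _ → ≈.refl A ; pres-J₀ = λ _ → ≈.refl A ; pres-J₁ = λ _ → ≈.refl A
  ; pres-J₂ = λ _ → ≈.refl A ; pres-∨ = λ _ _ → ≈.refl A ; pres-∧ = λ _ _ → ≈.refl A }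

_∘ₕ_ : ∀ {A B C} → Hom B C → Hom A B → Hom A C
_∘ₕ_ {C = C} g f = record
  { fun = fun g ∘ fun f ; resp = resp g ∘ resp f
  ; pres-⊥ = ≈.trans C (resp g (pres-⊥ f)) (pres-⊥ g)
  ; pres-⊤ = ≈.trans C (resp g (pres-⊤ f)) (pres-⊤ g)
  ; pres-¬ = λ x → ≈.trans C (resp g (pres-¬ f x)) (pres-¬ g _)
  ; pres-J₀ = λ x → ≈.trans C (resp g (pres-J₀ f x)) (pres-J₀ g _)
  ; pres-J₁ = λ x → ≈.trans C (resp g (pres-J₁ f x)) (pres-J₁ g _)
  ; pres-J₂ = λ x → ≈.trans C (resp g (pres-J₂ f x)) (pres-J₂ g _)
  ; pres-∨ = λ x y → ≈.trans C (resp g (pres-∨ f x y)) (pres-∨ g _ _)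
  ; pres-∧ = λ x y → ≈.trans C (resp g (pres-∧ f x y)) (pres-∧ g _ _) }

proj : (I : Set) (C : I → Algebra) (i : I) → Hom (Π I C) (C i)
proj I C i = record
  { fun = λ f → f i ; resp = λ p → p i ; pres-⊥ = ≈.refl (C i) ; pres-⊤ = ≈.refl (C i)
  ; pres-¬ = λ _ → ≈.refl (C i) ; pres-J₀ = λ _ → ≈.refl (C i) ; pres-J₁ = λ _ → ≈.refl (C i)
  ; pres-J₂ = λ _ → ≈.refl (C i) ; pres-∨ = λ _ _ → ≈.refl (C i) ; pres-∧ = λ _ _ → ≈.refl (C i) }

Iso-refl : (A : Algebra) → Iso A A
Iso-refl A = idHom A , (λ p → p) , λ a → a , ≈.refl A

Iso⇒Embedding : ∀ {A B} → Iso A B → Embedding A B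
Iso⇒Embedding (h , injective , _) = h , injective

⟦⟧-cong : (A : Algebra) (t : Term) {ρ ρ′ : ℕ → Carrier A} →
          (∀ n → _≈_ A (ρ n) (ρ′ n)) → _≈_ A (⟦ t ⟧ A ρ) (⟦ t ⟧ A ρ′)
⟦⟧-cong A (var n)  p = p n
⟦⟧-cong A `0       p = ≈.refl A
⟦⟧-cong A `1       p = ≈.refl A
⟦⟧-cong A (`¬ t)   p = ¬-cong A (⟦⟧-cong A t p)
⟦⟧-cong A (`J₀ t)  p = J₀-cong A (⟦⟧-cong A t p)
⟦⟧-cong A (`J₁ t)  p = J₁-cong A (⟦⟧-cong A t p)
⟦⟧-cong A (`J₂ t)  p = J₂-cong A (⟦⟧-cong A t p)
⟦⟧-cong A (t `∨ u) p = ∨-cong A (⟦⟧-cong A t p) (⟦⟧-cong A u p)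
⟦⟧-cong A (t `∧ u) p = ∧-cong A (⟦⟧-cong A t p) (⟦⟧-cong A u p)

⟦⟧-homomorphic : ∀ {A B} (h : Hom A B) (t : Term) (ρ : ℕ → Carrier A) →
                 _≈_ B (fun h (⟦ t ⟧ A ρ)) (⟦ t ⟧ B (fun h ∘ ρ))
⟦⟧-homomorphic {B = B} h (var n) ρ = ≈.refl B
⟦⟧-homomorphic h `0 ρ = pres-⊥ h
⟦⟧-homomorphic h `1 ρ = pres-⊤ h
⟦⟧-homomorphic {B = B} h (`¬ t) ρ =
  ≈.trans B (pres-¬ h _) (¬-cong B (⟦⟧-homomorphic h t ρ))
⟦⟧-homomorphic {B = B} h (`J₀ t) ρ =
  ≈.trans B (pres-J₀ h _) (J₀-cong B (⟦⟧-homomorphic h t ρ))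
⟦⟧-homomorphic {B = B} h (`J₁ t) ρ =
  ≈.trans B (pres-J₁ h _) (J₁-cong B (⟦⟧-homomorphic h t ρ))
⟦⟧-homomorphic {B = B} h (`J₂ t) ρ =
  ≈.trans B (pres-J₂ h _) (J₂-cong B (⟦⟧-homomorphic h t ρ))
⟦⟧-homomorphic {B = B} h (t `∨ u) ρ =
  ≈.trans B (pres-∨ h _ _) (∨-cong B (⟦⟧-homomorphic h t ρ) (⟦⟧-homomorphic h u ρ))
⟦⟧-homomorphic {B = B} h (t `∧ u) ρ =
  ≈.trans B (pres-∧ h _ _) (∧-cong B (⟦⟧-homomorphic h t ρ) (⟦⟧-homomorphic h u ρ))

⟦⟧-Π : (I : Set) (C : I → Algebra) (t : Term) (ρ : ℕ → Carrier (Π I C)) (i : I) →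
       ⟦ t ⟧ (Π I C) ρ i ≡ ⟦ t ⟧ (C i) (λ n → ρ n i)
⟦⟧-Π I C (var n)  ρ i = refl
⟦⟧-Π I C `0       ρ i = refl
⟦⟧-Π I C `1       ρ i = refl
⟦⟧-Π I C (`¬ t)   ρ i = cong (¬ₐ_ (C i)) (⟦⟧-Π I C t ρ i)
⟦⟧-Π I C (`J₀ t)  ρ i = cong (J₀ (C i)) (⟦⟧-Π I C t ρ i)
⟦⟧-Π I C (`J₁ t)  ρ i = cong (J₁ (C i)) (⟦⟧-Π I C t ρ i)
⟦⟧-Π I C (`J₂ t)  ρ i = cong (J₂ (C i)) (⟦⟧-Π I C t ρ i)
⟦⟧-Π I C (t `∨ u) ρ i = cong₂ (_∨ₐ_ (C i)) (⟦⟧-Π I C t ρ i) (⟦⟧-Π I C u ρ i)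
⟦⟧-Π I C (t `∧ u) ρ i = cong₂ (_∧ₐ_ (C i)) (⟦⟧-Π I C t ρ i) (⟦⟧-Π I C u ρ i)

holds-cong : (A : Algebra) (e : Equation) {ρ ρ′ : ℕ → Carrier A} →
             (∀ n → _≈_ A (ρ n) (ρ′ n)) → HoldsAt A ρ e → HoldsAt A ρ′ e
holds-cong A (t , u) ρ≈ρ′ p =
  ≈.trans A (≈.sym A (⟦⟧-cong A t ρ≈ρ′)) (≈.trans A p (⟦⟧-cong A u ρ≈ρ′))

holds-hom : ∀ {A B} (h : Hom A B) (ρ : ℕ → Carrier A) (e : Equation) →
            HoldsAt A ρ e → HoldsAt B (fun h ∘ ρ) e
holds-hom {B = B} h ρ (t , u) p =
  ≈.trans B (≈.sym B (⟦⟧-homomorphic h t ρ)) (≈.trans B (resp h p) (⟦⟧-homomorphic h u ρ))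

holds-Π : (I : Set) (C : I → Algebra) (ρ : ℕ → Carrier (Π I C)) (e : Equation) →
          HoldsAt (Π I C) ρ e → ∀ i → HoldsAt (C i) (λ n → ρ n i) e
holds-Π I C ρ (t , u) p i =
  ≈.trans (C i) (≈.reflexive (C i) (sym (⟦⟧-Π I C t ρ i)))
                (≈.trans (C i) (p i) (≈.reflexive (C i) (⟦⟧-Π I C u ρ i)))

holds-Π⁻¹ : (I : Set) (C : I → Algebra) (ρ : ℕ → Carrier (Π I C)) (e : Equation) →
            (∀ i → HoldsAt (C i) (λ n → ρ n i) e) → HoldsAt (Π I C) ρ e
holds-Π⁻¹ I C ρ (t , u) p i =
  ≈.trans (C i) (≈.reflexive (C i) (⟦⟧-Π I C t ρ i))
                (≈.trans (C i) (p i) (≈.reflexive (C i) (sym (⟦⟧-Π I C u ρ i))))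

holds-injective : ∀ {A B} (h : Hom A B) → Injective h → (ρ : ℕ → Carrier A) (e : Equation) →
                  HoldsAt B (fun h ∘ ρ) e → HoldsAt A ρ e
holds-injective {B = B} h injective ρ (t , u) p =
  injective (≈.trans B (⟦⟧-homomorphic h t ρ) (≈.trans B p (≈.sym B (⟦⟧-homomorphic h u ρ))))

⊨-embedding : ∀ {A B} → Embedding A B → (q : QuasiIdentity) → B ⊨ q → A ⊨ q
⊨-embedding (h , injective) (prem , e) B⊨q ρ premises =
  holds-injective h injective ρ e (B⊨q (fun h ∘ ρ) (All.map (λ {e′} → holds-hom h ρ e′) premises))

⊨-Π : (I : Set) (C : I → Algebra) (q : QuasiIdentity) → (∀ i → C i ⊨ q) → Π I C ⊨ q
⊨-Π I C (prem , e) C⊨q ρ premises =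
  holds-Π⁻¹ I C ρ e λ i → C⊨q i (λ n → ρ n i) (All.map (λ {e′} p → holds-Π I C ρ e′ p i) premises)

⊨-SP : ∀ {K} (q : QuasiIdentity) → (∀ A → K A → A ⊨ q) → ∀ A → S (P K) A → A ⊨ q
⊨-SP q K⊨q A (B , (I , C , C∈K , B≅ΠC) , A↪B) =
  ⊨-embedding A↪B q (⊨-embedding (Iso⇒Embedding B≅ΠC) q (⊨-Π I C q λ i → K⊨q (C i) (C∈K i)))

𝕍-mono : ∀ {K K′} → K ⊆ K′ → 𝕍 K ⊆ 𝕍 K′
𝕍-mono K⊆K′ A (B , (B′ , (I , C , C∈K , B′≅ΠC) , B↪B′) , B↠A) =
  B , (B′ , (I , C , (λ i → K⊆K′ (C i) (C∈K i)) , B′≅ΠC) , B↪B′) , B↠A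

K⊆𝕍K : ∀ {K} → K ⊆ 𝕍 K
K⊆𝕍K {K} A A∈K = A¹ , (A¹ , (⊤ , (λ _ → A) , (λ _ → A∈K) , Iso-refl A¹) , idHom A¹ , (λ p → p))
                   , proj ⊤ (λ _ → A) tt , λ a → (λ _ → a) , ≈.refl A
  where A¹ = Π ⊤ (λ _ → A)

record Separated (A : Algebra) : Set₁ where
  field
    Index             : Set
    coord             : Index → Hom A WKe
    jointly-injective : ∀ {x y} → (∀ i → fun (coord i) x ≡ fun (coord i) y) → _≈_ A x y

  holds-coordinatewise : (ρ : ℕ → Carrier A) (e : Equation) →
                         (∀ i → HoldsAt WKe (fun (coord i) ∘ ρ) e) → HoldsAt A ρ e
  holds-coordinatewise ρ (t , u) p = jointly-injective λ i →
    trans (⟦⟧-homomorphic (coord i) t ρ) (trans (p i) (sym (⟦⟧-homomorphic (coord i) u ρ)))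

Separated-embedding : ∀ {A B} → Embedding A B → Separated B → Separated A
Separated-embedding (h , injective) sep = record
  { Index = Index ; coord = λ i → coord i ∘ₕ h ; jointly-injective = injective ∘ jointly-injective }
  where open Separated sep

Separated-Π : (I : Set) (C : I → Algebra) → (∀ i → Separated (C i)) → Separated (Π I C)
Separated-Π I C sep = record
  { Index = Σ I (Separated.Index ∘ sep)
  ; coord = λ { (i , k) → Separated.coord (sep i) k ∘ₕ proj I C i }
  ; jointly-injective = λ p i → Separated.jointly-injective (sep i) λ k → p (i , k) }

WKe-separated : Separated WKe
WKe-separated = record { Index = ⊤ ; coord = λ _ → idHom WKe ; jointly-injective = λ p → p tt }

SP-Separated : ∀ {K} → K ⊆ Separated → S (P K) ⊆ Separated
SP-Separated K-sep A (B , (I , C , C∈K , B≅ΠC) , A↪B) =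
  Separated-embedding A↪B (Separated-embedding (Iso⇒Embedding B≅ΠC)
    (Separated-Π I C λ i → K-sep (C i) (C∈K i)))

BCA⇒Separated : BCA ⊆ Separated
BCA⇒Separated = SP-Separated λ A A≅WKe → Separated-embedding (Iso⇒Embedding (lower A≅WKe)) WKe-separated

𝔽 : Algebra
𝔽 = record
  { Carrier = Term ; _≈_ = λ t u → ∀ σ → ⟦ t ⟧ WKe σ ≡ ⟦ u ⟧ WKe σ
  ; isEquiv = record { refl = λ σ → refl ; sym = λ p σ → sym (p σ) ; trans = λ p q σ → trans (p σ) (q σ) }
  ; ⊥ₐ = `0 ; ⊤ₐ = `1 ; ¬ₐ_ = `¬ ; J₀ = `J₀ ; J₁ = `J₁ ; J₂ = `J₂ ; _∨ₐ_ = _`∨_ ; _∧ₐ_ = _`∧_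
  ; ¬-cong = λ p σ → cong negW (p σ) ; J₀-cong = λ p σ → cong J0W (p σ)
  ; J₁-cong = λ p σ → cong J1W (p σ) ; J₂-cong = λ p σ → cong J2W (p σ)
  ; ∨-cong = λ p q σ → cong₂ joinW (p σ) (q σ) ; ∧-cong = λ p q σ → cong₂ meetW (p σ) (q σ) }

⟦⟧-subst : (t : Term) (τ : ℕ → Term) (σ : ℕ → W) →
           ⟦ ⟦ t ⟧ 𝔽 τ ⟧ WKe σ ≡ ⟦ t ⟧ WKe (λ n → ⟦ τ n ⟧ WKe σ)
⟦⟧-subst (var n)  τ σ = refl
⟦⟧-subst `0       τ σ = refl
⟦⟧-subst `1       τ σ = refl
⟦⟧-subst (`¬ t)   τ σ = cong negW (⟦⟧-subst t τ σ)
⟦⟧-subst (`J₀ t)  τ σ = cong J0W (⟦⟧-subst t τ σ)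
⟦⟧-subst (`J₁ t)  τ σ = cong J1W (⟦⟧-subst t τ σ)
⟦⟧-subst (`J₂ t)  τ σ = cong J2W (⟦⟧-subst t τ σ)
⟦⟧-subst (t `∨ u) τ σ = cong₂ joinW (⟦⟧-subst t τ σ) (⟦⟧-subst u τ σ)
⟦⟧-subst (t `∧ u) τ σ = cong₂ meetW (⟦⟧-subst t τ σ) (⟦⟧-subst u τ σ)

⟦⟧-var : (t : Term) → ⟦ t ⟧ 𝔽 var ≡ t
⟦⟧-var (var n)  = refl
⟦⟧-var `0       = refl
⟦⟧-var `1       = refl
⟦⟧-var (`¬ t)   = cong `¬ (⟦⟧-var t)
⟦⟧-var (`J₀ t)  = cong `J₀ (⟦⟧-var t)
⟦⟧-var (`J₁ t)  = cong `J₁ (⟦⟧-var t)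
⟦⟧-var (`J₂ t)  = cong `J₂ (⟦⟧-var t)
⟦⟧-var (t `∨ u) = cong₂ _`∨_ (⟦⟧-var t) (⟦⟧-var u)
⟦⟧-var (t `∧ u) = cong₂ _`∧_ (⟦⟧-var t) (⟦⟧-var u)

holds-𝔽 : (τ : ℕ → Term) (e : Equation) →
          (∀ σ → HoldsAt WKe (λ n → ⟦ τ n ⟧ WKe σ) e) → HoldsAt 𝔽 τ e
holds-𝔽 τ (t , u) p σ = trans (⟦⟧-subst t τ σ) (trans (p σ) (sym (⟦⟧-subst u τ σ)))

holds-𝔽⁻¹ : (τ : ℕ → Term) (e : Equation) →
            HoldsAt 𝔽 τ e → ∀ σ → HoldsAt WKe (λ n → ⟦ τ n ⟧ WKe σ) e
holds-𝔽⁻¹ τ (t , u) p σ = trans (sym (⟦⟧-subst t τ σ)) (trans (p σ) (⟦⟧-subst u τ σ))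

-- Interpreting the generators at preimages of the variables splits g; it respects ≈ because B satisfies every identity of WKᵉ.
𝔽-embeds-into-cover : ∀ {B} → Separated B → (g : Hom B 𝔽) → Surjective g → Embedding 𝔽 B
𝔽-embeds-into-cover {B} sep g g-onto = h , λ {t} {u} → injective {t} {u}
  where
  open Separated sep
  d : ℕ → Carrier B
  d n = proj₁ (g-onto (var n))
  h : Hom 𝔽 B
  h = record
    { fun = λ t → ⟦ t ⟧ B d ; resp = λ {t} {u} p → holds-coordinatewise d (t , u) λ i → p (fun (coord i) ∘ d)
    ; pres-⊥ = ≈.refl B ; pres-⊤ = ≈.refl B ; pres-¬ = λ _ → ≈.refl B
    ; pres-J₀ = λ _ → ≈.refl B ; pres-J₁ = λ _ → ≈.refl B ; pres-J₂ = λ _ → ≈.refl B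
    ; pres-∨ = λ _ _ → ≈.refl B ; pres-∧ = λ _ _ → ≈.refl B }
  g∘h≈id : ∀ t → _≈_ 𝔽 (fun g (fun h t)) t
  g∘h≈id t σ = trans (⟦⟧-homomorphic g t d σ)
    (trans (⟦⟧-cong 𝔽 t (λ n → proj₂ (g-onto (var n))) σ) (cong (λ u → ⟦ u ⟧ WKe σ) (⟦⟧-var t)))
  injective : Injective h
  injective {t} {u} p σ = trans (sym (g∘h≈id t σ)) (trans (resp g p σ) (g∘h≈id u σ))

𝔽-⊨-of-𝕍 : ∀ {K} → K ⊆ Separated → 𝕍 K 𝔽 → (q : QuasiIdentity) → (∀ A → K A → A ⊨ q) → 𝔽 ⊨ q
𝔽-⊨-of-𝕍 K-sep (B , B∈SPK , g , g-onto) q K⊨q =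
  ⊨-embedding (𝔽-embeds-into-cover (SP-Separated K-sep B B∈SPK) g g-onto) q (⊨-SP q K⊨q B B∈SPK)

data Boolean : W → Set where
  b0 : Boolean w0
  b1 : Boolean w1

½-or-Boolean : (x : W) → x ≡ wh ⊎ Boolean x
½-or-Boolean w0 = inj₂ b0
½-or-Boolean wh = inj₁ refl
½-or-Boolean w1 = inj₂ b1

_≟_ : DecidableEquality W
w0 ≟ w0 = yes refl
w0 ≟ wh = no λ ()
w0 ≟ w1 = no λ ()
wh ≟ w0 = no λ ()
wh ≟ wh = yes refl
wh ≟ w1 = no λ ()
w1 ≟ w0 = no λ ()
w1 ≟ wh = no λ ()
w1 ≟ w1 = yes refl

¬-Boolean : ∀ {x} → Boolean x → Boolean (negW x)
¬-Boolean b0 = b1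
¬-Boolean b1 = b0

J₀-Boolean : ∀ x → Boolean (J0W x)
J₀-Boolean w0 = b1
J₀-Boolean wh = b0
J₀-Boolean w1 = b0

J₁-Boolean : ∀ x → Boolean (J1W x)
J₁-Boolean w0 = b0
J₁-Boolean wh = b1
J₁-Boolean w1 = b0

J₂-Boolean : ∀ x → Boolean (J2W x)
J₂-Boolean w0 = b0
J₂-Boolean wh = b0
J₂-Boolean w1 = b1

∨-Boolean : ∀ {x y} → Boolean x → Boolean y → Boolean (joinW x y)
∨-Boolean b0 b0 = b0
∨-Boolean b0 b1 = b1
∨-Boolean b1 b0 = b1
∨-Boolean b1 b1 = b1

∧-Boolean : ∀ {x y} → Boolean x → Boolean y → Boolean (meetW x y)
∧-Boolean b0 b0 = b0
∧-Boolean b0 b1 = b0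
∧-Boolean b1 b0 = b0
∧-Boolean b1 b1 = b1

∨-Boolean⁻¹ : ∀ x {y} → Boolean (joinW x y) → Boolean x × Boolean y
∨-Boolean⁻¹ w0 {w0} _ = b0 , b0
∨-Boolean⁻¹ w0 {w1} _ = b0 , b1
∨-Boolean⁻¹ w1 {w0} _ = b1 , b0
∨-Boolean⁻¹ w1 {w1} _ = b1 , b1
∨-Boolean⁻¹ wh ()
∨-Boolean⁻¹ w0 {wh} ()
∨-Boolean⁻¹ w1 {wh} ()

⟦⟧-Boolean : (σ : ℕ → W) → (∀ n → Boolean (σ n)) → (t : Term) → Boolean (⟦ t ⟧ WKe σ)
⟦⟧-Boolean σ σ-Boolean (var n)  = σ-Boolean n
⟦⟧-Boolean σ σ-Boolean `0       = b0
⟦⟧-Boolean σ σ-Boolean `1       = b1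
⟦⟧-Boolean σ σ-Boolean (`¬ t)   = ¬-Boolean (⟦⟧-Boolean σ σ-Boolean t)
⟦⟧-Boolean σ σ-Boolean (`J₀ t)  = J₀-Boolean _
⟦⟧-Boolean σ σ-Boolean (`J₁ t)  = J₁-Boolean _
⟦⟧-Boolean σ σ-Boolean (`J₂ t)  = J₂-Boolean _
⟦⟧-Boolean σ σ-Boolean (t `∨ u) = ∨-Boolean (⟦⟧-Boolean σ σ-Boolean t) (⟦⟧-Boolean σ σ-Boolean u)
⟦⟧-Boolean σ σ-Boolean (t `∧ u) = ∧-Boolean (⟦⟧-Boolean σ σ-Boolean t) (⟦⟧-Boolean σ σ-Boolean u)

J₁-Boolean≢w1 : ∀ {x} → Boolean x → J1W x ≢ w1
J₁-Boolean≢w1 b0 ()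
J₁-Boolean≢w1 b1 ()

𝔽-embeds-in-power : Embedding 𝔽 (Π (ℕ → W) λ _ → WKe)
𝔽-embeds-in-power = evaluation , λ p → p
  where
  evaluation : Hom 𝔽 (Π (ℕ → W) λ _ → WKe)
  evaluation = record
    { fun = λ t σ → ⟦ t ⟧ WKe σ ; resp = λ p → p ; pres-⊥ = λ _ → refl ; pres-⊤ = λ _ → refl
    ; pres-¬ = λ _ _ → refl ; pres-J₀ = λ _ _ → refl ; pres-J₁ = λ _ _ → refl ; pres-J₂ = λ _ _ → refl
    ; pres-∨ = λ _ _ _ → refl ; pres-∧ = λ _ _ _ → refl }

𝔽∈NBCA : NBCA 𝔽
𝔽∈NBCA = ( Π (ℕ → W) (λ _ → WKe)
         , ((ℕ → W) , (λ _ → WKe) , (λ _ → lift (Iso-refl WKe)) , Iso-refl _)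
         , 𝔽-embeds-in-power )
       , lift 𝔽⊨nbca-qi
  where
  𝔽⊨nbca-qi : 𝔽 ⊨ nbca-qi
  𝔽⊨nbca-qi ρ (J₁x≈1 ∷ []) =
    ⊥-elim (J₁-Boolean≢w1 (⟦⟧-Boolean (λ _ → w0) (λ _ → b0) (ρ 0)) (J₁x≈1 λ _ → w0))

-- ⟦ varJoin t ⟧ σ is Boolean exactly when σ is Boolean on every variable of t.
varJoin : Term → Term
varJoin (var n)  = var n
varJoin `0       = `0
varJoin `1       = `0
varJoin (`¬ t)   = varJoin t
varJoin (`J₀ t)  = varJoin t
varJoin (`J₁ t)  = varJoin t
varJoin (`J₂ t)  = varJoin t
varJoin (t `∨ u) = varJoin t `∨ varJoin u
varJoin (t `∧ u) = varJoin t `∨ varJoin u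

equationVars : Equation → Term
equationVars (t , u) = varJoin t `∨ varJoin u

premiseVars : List Equation → Term
premiseVars []       = `0
premiseVars (e ∷ es) = equationVars e `∨ premiseVars es

booleanPart : W → W
booleanPart w1 = w1
booleanPart _  = w0

booleanPart-Boolean : ∀ {x} → Boolean x → booleanPart x ≡ x
booleanPart-Boolean b0 = refl
booleanPart-Boolean b1 = refl

⟦⟧-booleanPart : (σ : ℕ → W) (t : Term) → Boolean (⟦ varJoin t ⟧ WKe σ) →
                 ⟦ t ⟧ WKe (booleanPart ∘ σ) ≡ ⟦ t ⟧ WKe σ
⟦⟧-booleanPart σ (var n)  vars-Boolean = booleanPart-Boolean vars-Boolean
⟦⟧-booleanPart σ `0       vars-Boolean = refl
⟦⟧-booleanPart σ `1       vars-Boolean = refl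
⟦⟧-booleanPart σ (`¬ t)   vars-Boolean = cong negW (⟦⟧-booleanPart σ t vars-Boolean)
⟦⟧-booleanPart σ (`J₀ t)  vars-Boolean = cong J0W (⟦⟧-booleanPart σ t vars-Boolean)
⟦⟧-booleanPart σ (`J₁ t)  vars-Boolean = cong J1W (⟦⟧-booleanPart σ t vars-Boolean)
⟦⟧-booleanPart σ (`J₂ t)  vars-Boolean = cong J2W (⟦⟧-booleanPart σ t vars-Boolean)
⟦⟧-booleanPart σ (t `∨ u) vars-Boolean =
  let t-Boolean , u-Boolean = ∨-Boolean⁻¹ (⟦ varJoin t ⟧ WKe σ) vars-Boolean
  in cong₂ joinW (⟦⟧-booleanPart σ t t-Boolean) (⟦⟧-booleanPart σ u u-Boolean)
⟦⟧-booleanPart σ (t `∧ u) vars-Boolean =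
  let t-Boolean , u-Boolean = ∨-Boolean⁻¹ (⟦ varJoin t ⟧ WKe σ) vars-Boolean
  in cong₂ meetW (⟦⟧-booleanPart σ t t-Boolean) (⟦⟧-booleanPart σ u u-Boolean)

holds-booleanPart : (σ : ℕ → W) (e : Equation) → Boolean (⟦ equationVars e ⟧ WKe σ) →
                    HoldsAt WKe σ e → HoldsAt WKe (booleanPart ∘ σ) e
holds-booleanPart σ (t , u) vars-Boolean p =
  let t-Boolean , u-Boolean = ∨-Boolean⁻¹ (⟦ varJoin t ⟧ WKe σ) vars-Boolean
  in trans (⟦⟧-booleanPart σ t t-Boolean) (trans p (sym (⟦⟧-booleanPart σ u u-Boolean)))

select : W → W → W → W
select wh a _ = a
select _  _ b = booleanPart b

constant : W → Term
constant w1 = `1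
constant _  = `0

switch : W → W → Term
switch wh b = (var 0 `∧ `0) `∨ constant b
switch a  b = (`J₁ (var 0) `∧ constant a) `∨ (`¬ (`J₁ (var 0)) `∧ constant b)

switch-unary : ∀ a b (σ : ℕ → W) → ⟦ switch a b ⟧ WKe σ ≡ ⟦ switch a b ⟧ WKe (λ _ → σ 0)
switch-unary w0 w0 σ = refl
switch-unary w0 wh σ = refl
switch-unary w0 w1 σ = refl
switch-unary wh w0 σ = refl
switch-unary wh wh σ = refl
switch-unary wh w1 σ = refl
switch-unary w1 w0 σ = refl
switch-unary w1 wh σ = refl
switch-unary w1 w1 σ = refl

switch-table : ∀ x a b → ⟦ switch a b ⟧ WKe (λ _ → x) ≡ select x a b
switch-table wh wh b = refl
switch-table w0 w0 w0 = refl
switch-table w0 w0 wh = refl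
switch-table w0 w0 w1 = refl
switch-table w0 wh w0 = refl
switch-table w0 wh wh = refl
switch-table w0 wh w1 = refl
switch-table w0 w1 w0 = refl
switch-table w0 w1 wh = refl
switch-table w0 w1 w1 = refl
switch-table wh w0 w0 = refl
switch-table wh w0 wh = refl
switch-table wh w0 w1 = refl
switch-table wh w1 w0 = refl
switch-table wh w1 wh = refl
switch-table wh w1 w1 = refl
switch-table w1 w0 w0 = refl
switch-table w1 w0 wh = refl
switch-table w1 w0 w1 = refl
switch-table w1 wh w0 = refl
switch-table w1 wh wh = refl
switch-table w1 wh w1 = refl
switch-table w1 w1 w0 = refl
switch-table w1 w1 wh = refl
switch-table w1 w1 w1 = refl

switch-eval : ∀ a b (σ : ℕ → W) → ⟦ switch a b ⟧ WKe σ ≡ select (σ 0) a b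
switch-eval a b σ = trans (switch-unary a b σ) (switch-table (σ 0) a b)

-- Glue σ and σ′ along the fresh switch variable x₀: at x₀ = ½ one recovers σ, and at x₀ ∈ {0, 1} the Boolean part of σ′.
module Gluing (σ σ′ : ℕ → W) where

  glued : ℕ → Term
  glued n = switch (σ n) (σ′ n)

  glued-holds : (e : Equation) → Boolean (⟦ equationVars e ⟧ WKe σ′) →
                HoldsAt WKe σ e → HoldsAt WKe σ′ e → HoldsAt 𝔽 glued e
  glued-holds e vars-Boolean p p′ = holds-𝔽 glued e λ ρ →
    holds-cong WKe e (λ n → sym (switch-eval (σ n) (σ′ n) ρ)) (holds-at (ρ 0))
    where
    holds-at : ∀ x → HoldsAt WKe (λ n → select x (σ n) (σ′ n)) e
    holds-at w0 = holds-booleanPart σ′ e vars-Boolean p′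
    holds-at wh = p
    holds-at w1 = holds-booleanPart σ′ e vars-Boolean p′

  glued-premises : (prem : List Equation) → Boolean (⟦ premiseVars prem ⟧ WKe σ′) →
                   All (HoldsAt WKe σ) prem → All (HoldsAt WKe σ′) prem → All (HoldsAt 𝔽 glued) prem
  glued-premises [] _ [] [] = []
  glued-premises (e ∷ es) vars-Boolean (p ∷ ps) (p′ ∷ ps′) =
    let e-Boolean , es-Boolean = ∨-Boolean⁻¹ (⟦ equationVars e ⟧ WKe σ′) vars-Boolean
    in glued-holds e e-Boolean p p′ ∷ glued-premises es es-Boolean ps ps′

  glued-at-½ : ∀ n → ⟦ glued n ⟧ WKe (λ _ → wh) ≡ σ n
  glued-at-½ n = switch-eval (σ n) (σ′ n) (λ _ → wh)

𝔽-quasi-identity-in-WKe : (prem : List Equation) (e : Equation) → 𝔽 ⊨ (prem , e) →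
  (σ σ′ : ℕ → W) → All (HoldsAt WKe σ) prem → All (HoldsAt WKe σ′) prem →
  Boolean (⟦ premiseVars prem ⟧ WKe σ′) → HoldsAt WKe σ e
𝔽-quasi-identity-in-WKe prem e 𝔽⊨q σ σ′ ps ps′ vars-Boolean =
  holds-cong WKe e glued-at-½ (holds-𝔽⁻¹ glued e (𝔽⊨q glued (glued-premises prem vars-Boolean ps ps′)) λ _ → wh)
  where open Gluing σ σ′

J₁≉⊤ : ∀ {A} → A ⊨ nbca-qi → Hom A WKe → ∀ x → ¬ _≈_ A (J₁ A x) (⊤ₐ A)
J₁≉⊤ {A} A⊨nbca-qi h x J₁x≈1 = w0≢w1 (trans (sym (pres-⊥ h)) (trans (resp h 0≈1) (pres-⊤ h)))
  where
  ρ : ℕ → Carrier A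
  ρ zero    = x
  ρ (suc _) = ⊥ₐ A
  0≈1 : _≈_ A (⊥ₐ A) (⊤ₐ A)
  0≈1 = A⊨nbca-qi ρ (J₁x≈1 ∷ [])
  w0≢w1 : w0 ≢ w1
  w0≢w1 ()

𝔽-⊨⇒NBCA-⊨ : ∀ {A} → NBCA A → (q : QuasiIdentity) → 𝔽 ⊨ q → A ⊨ q
𝔽-⊨⇒NBCA-⊨ {A} (A∈BCA , lift A⊨nbca-qi) (prem , (s , t)) 𝔽⊨q ρ ps =
  holds-coordinatewise ρ (s , t) conclusion
  where
  open Separated (BCA⇒Separated A A∈BCA)
  σ : Index → ℕ → W
  σ i = fun (coord i) ∘ ρ
  premises : ∀ i → All (HoldsAt WKe (σ i)) prem
  premises i = All.map (λ {e} → holds-hom (coord i) ρ e) ps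
  D : Term
  D = premiseVars prem
  conclusion : ∀ i → HoldsAt WKe (σ i) (s , t)
  conclusion i with ⟦ s ⟧ WKe (σ i) ≟ ⟦ t ⟧ WKe (σ i)
  ... | yes s≡t = s≡t
  ... | no s≢t = ⊥-elim (J₁≉⊤ A⊨nbca-qi (coord i) (⟦ D ⟧ A ρ) (holds-coordinatewise ρ (`J₁ D , `1) J₁D≡1))
    where
    J₁D≡1 : ∀ j → J1W (⟦ D ⟧ WKe (σ j)) ≡ w1
    J₁D≡1 j with ½-or-Boolean (⟦ D ⟧ WKe (σ j))
    ... | inj₁ D≡½ = cong J1W D≡½
    ... | inj₂ D-Boolean =
      ⊥-elim (s≢t (𝔽-quasi-identity-in-WKe prem (s , t) 𝔽⊨q (σ i) (σ j) (premises i) (premises j) D-Boolean))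

corollary3p10 : StructurallyComplete NBCA
corollary3p10 K′ (Σq , K′≡Mod) (K′⊆NBCA , NBCA⊈K′) = 𝕍-mono K′⊆NBCA , 𝕍NBCA⊈𝕍K′
  where
  K′⊨ : ∀ q → Σq q → ∀ A → K′ A → A ⊨ q
  K′⊨ q q∈Σq A A∈K′ = lower (proj₁ (K′≡Mod A) A∈K′) q q∈Σq
  K′-separated : K′ ⊆ Separated
  K′-separated A A∈K′ = BCA⇒Separated A (proj₁ (K′⊆NBCA A A∈K′))
  𝕍NBCA⊈𝕍K′ : ¬ (𝕍 NBCA ⊆ 𝕍 K′)
  𝕍NBCA⊈𝕍K′ 𝕍NBCA⊆𝕍K′ = NBCA⊈K′ λ A A∈NBCA → proj₂ (K′≡Mod A) (lift λ q q∈Σq →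
    𝔽-⊨⇒NBCA-⊨ A∈NBCA q (𝔽-⊨-of-𝕍 K′-separated 𝔽∈𝕍K′ q (K′⊨ q q∈Σq)))
    where
    𝔽∈𝕍K′ : 𝕍 K′ 𝔽
    𝔽∈𝕍K′ = 𝕍NBCA⊆𝕍K′ 𝔽 (K⊆𝕍K {NBCA} 𝔽 𝔽∈NBCA)
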